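{- Let $T$ be a tournament whose directed domination graph $\vec{D}(T)$ contains a directed cycle $C$ with $V(C)=V(T)$. Then $T$ has a unique minimal $\tau$-retentive set.
   Context: A tournament $T$ consists of a finite vertex set $V(T)$ and an asymmetric, complete binary relation $\succ$ on $V(T)$ ($x$ dominates $y$ if $x\succ y$). For $v\in V(T)$ let $N^-_T(v)=\{u: u\succ v\}$; for $B\subseteq V(T)$, $T[B]$ is the induced subtournament. A vertex $u$ is the captain of a vertex $v$ in $T$ if $u\succ v$ and $u\succ w$ for every $w\in N^-_T(v)\setminus\{u\}$. The directed domination graph $\vec{D}(T)$ has vertex set $V(T)$ and an arc from $u$ to $v$ iff $u$ is the captain of $v$ in $T$. A directed cycle is a sequence of distinct vertices $(v_0,\dots,v_{k-1})$ with an arc from $v_i$ to $v_{(i+1)\bmod k}$ for all $i$; $V(C)$ is its vertex set. The tournament equilibrium set $\tau$ is defined recursively: a nonempty $A\subseteq V(T)$ is $\tau$-retentive if for every $v\in A$ with $N^-_T(v)\neq\emptyset$, $\tau(T[N^-_T(v)])\subseteq A$; $A$ is a minimal $\tau$-retentive set if no $\tau$-retentive set of $T$ is a proper subset of $A$; $\tau(T)$ is the union of all minimal $\tau$-retentive sets of $T$. -}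

module Defs where

open import Data.Nat using (ℕ; zero; suc)
open import Data.Fin using (Fin; zero; suc; inject₁; fromℕ)
open import Data.Fin.Subset using (Subset; _∈_; _⊆_; Nonempty)
open import Data.Fin.Subset.Properties using (_∈?_)
open import Data.Bool using (Bool; true; _∧_)
open import Data.Vec using (tabulate)
open import Data.Product using (_×_; Σ; ∃)
open import Data.Sum using (_⊎_)
open import Data.Empty using (⊥)
open import Relation.Nullary using (¬_; Dec)
open import Relation.Nullary.Decidable using (⌊_⌋)
open import Relation.Binary.PropositionalEquality using (_≡_; _≢_)
open import Function.Definitions using (Injective)

record Tournament : Set₁ where
  field
    n      : ℕ
    _≻_    : Fin n → Fin n → Set
    _≻?_   : (x y : Fin n) → Dec (x ≻ y)
    asym   : ∀ {x y} → x ≻ y → ¬ (y ≻ x)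
    complete : ∀ {x y} → x ≢ y → (x ≻ y) ⊎ (y ≻ x)

module _ (T : Tournament) where
  open Tournament T

  inN : Subset n → Fin n → Subset n
  inN B v = tabulate (λ u → ⌊ u ∈? B ⌋ ∧ ⌊ u ≻? v ⌋)

  -- τ of the induced subtournament T[B], as a predicate on vertices,
  -- computed with a fuel parameter (see τ below).
  τF : ℕ → Subset n → Fin n → Set
  retF : ℕ → Subset n → Subset n → Set
  minF : ℕ → Subset n → Subset n → Set

  retF k B A = (A ⊆ B) × Nonempty A ×
    (∀ v → v ∈ A → Nonempty (inN B v) → ∀ x → τF k (inN B v) x → x ∈ A)
  minF k B A = retF k B A × (∀ A' → retF k B A' → ¬ ((A' ⊆ A) × (A' ≢ A)))

  τF zero    B x = ⊥
  τF (suc k) B x = ∃ λ A → minF k B A × x ∈ A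

  -- Fuel suc n suffices: each recursive call is on an in-neighbourhood
  -- inN B v with v ∈ B, which has strictly fewer elements than B.
  τ : Subset n → Fin n → Set
  τ B x = τF (suc n) B x

  full : Subset n
  full = tabulate (λ _ → true)

  Retentive : Subset n → Set
  Retentive A = retF n full A

  MinimalRetentive : Subset n → Set
  MinimalRetentive A = Retentive A × (∀ A' → Retentive A' → ¬ ((A' ⊆ A) × (A' ≢ A)))

  Captain : Fin n → Fin n → Set
  Captain u v = (u ≻ v) × (∀ w → w ≻ v → w ≢ u → u ≻ w)

  -- D(T) has a directed cycle through all vertices: distinct vertices
  -- c 0, ..., c m with arcs c i → c (i+1) and c m → c 0, covering V(T).
  HamiltonianDomCycle : Set
  HamiltonianDomCycle =
    Σ ℕ λ m → Σ (Fin (suc m) → Fin n) λ c →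
      Injective _≡_ _≡_ c ×
      (∀ x → ∃ λ i → c i ≡ x) ×
      (∀ (i : Fin m) → Captain (c (inject₁ i)) (c (suc i))) ×
      Captain (c (fromℕ m)) (c zero)

-- A τ-retentive set A is closed under captains: if u is the captain of v, then u
-- dominates every other in-neighbour of v, so {u} is the unique minimal τ-retentive
-- set of T[N⁻(v)] and τ(T[N⁻(v)]) contains u; hence v ∈ A forces u ∈ A.  Walking
-- backwards along a Hamiltonian cycle of captain arcs, every τ-retentive set is V(T),
-- which is therefore the unique minimal one.
module Submission where

open import Defs
open import Data.Nat using (zero; suc; pred)
open import Data.Nat.Properties using (suc-pred)
open import Data.Fin using (Fin; zero; suc; inject₁; fromℕ)
open import Data.Fin.Properties using (nonZeroIndex)
open import Data.Fin.Subset using (Subset; _∈_; _⊆_; Nonempty; ⁅_⁆)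
open import Data.Fin.Subset.Properties using (_∈?_; x∈⁅x⁆; x∈⁅y⁆⇒x≡y; ⊆-antisym)
open import Data.Bool using (Bool; T)
open import Data.Bool.Properties using (T-≡; T-∧)
open import Data.Vec using (tabulate)
open import Data.Vec.Properties using ([]=⇒lookup; lookup⇒[]=; lookup∘tabulate)
open import Data.Product using (_×_; ∃; _,_; proj₁; proj₂)
open import Data.Empty using (⊥-elim)
open import Function.Base using (_∘_; id)
open import Function.Bundles using (Equivalence)
open import Relation.Nullary using (¬_)
open import Relation.Nullary.Decidable using (toWitness; fromWitness)
open import Relation.Binary.PropositionalEquality using (_≡_; _≢_; refl; sym; trans; subst)

∈-tabulate⁺ : ∀ {n} (f : Fin n → Bool) {x} → T (f x) → x ∈ tabulate f
∈-tabulate⁺ f {x} t =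
  lookup⇒[]= x (tabulate f) (trans (lookup∘tabulate f x) (Equivalence.to T-≡ t))

∈-tabulate⁻ : ∀ {n} (f : Fin n → Bool) {x} → x ∈ tabulate f → T (f x)
∈-tabulate⁻ f {x} x∈ =
  Equivalence.from T-≡ (trans (sym (lookup∘tabulate f x)) ([]=⇒lookup x∈))

nonempty-⊆⁅x⁆⇒≡⁅x⁆ : ∀ {n} {p : Subset n} {x} → Nonempty p → p ⊆ ⁅ x ⁆ → p ≡ ⁅ x ⁆
nonempty-⊆⁅x⁆⇒≡⁅x⁆ {p = p} {x} (y , y∈p) p⊆⁅x⁆ = ⊆-antisym p⊆⁅x⁆ ⁅x⁆⊆p
  where
  x∈p : x ∈ p
  x∈p = subst (_∈ p) (x∈⁅y⁆⇒x≡y x (p⊆⁅x⁆ y∈p)) y∈p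

  ⁅x⁆⊆p : ⁅ x ⁆ ⊆ p
  ⁅x⁆⊆p z∈⁅x⁆ = subst (_∈ p) (sym (x∈⁅y⁆⇒x≡y x z∈⁅x⁆)) x∈p

PredecessorClosed : ∀ {m} → (Fin (suc m) → Set) → Set
PredecessorClosed {m} P = ∀ (i : Fin m) → P (suc i) → P (inject₁ i)

predecessorClosed⇒zero : ∀ {m} {P : Fin (suc m) → Set} → PredecessorClosed P →
  ∀ i → P i → P zero
predecessorClosed⇒zero             closed zero    p = p
predecessorClosed⇒zero {suc m} {P} closed (suc i) p =
  closed zero (predecessorClosed⇒zero {P = P ∘ suc} (closed ∘ suc) i p)

predecessorClosed⇒all : ∀ {m} {P : Fin (suc m) → Set} → PredecessorClosed P →
  P (fromℕ m) → ∀ i → P i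
predecessorClosed⇒all {zero}      closed p zero    = p
predecessorClosed⇒all {suc m} {P} closed p (suc i) =
  predecessorClosed⇒all {P = P ∘ suc} (closed ∘ suc) p i
predecessorClosed⇒all {suc m} {P} closed p zero    =
  closed zero (predecessorClosed⇒all {P = P ∘ suc} (closed ∘ suc) p zero)

cyclicallyClosed⇒all : ∀ {m} {P : Fin (suc m) → Set} → PredecessorClosed P →
  (P zero → P (fromℕ m)) → ∀ {i} → P i → ∀ j → P j
cyclicallyClosed⇒all closed wrap {i} p =
  predecessorClosed⇒all closed (wrap (predecessorClosed⇒zero closed i p))

module _ (T : Tournament) where
  open Tournament T

  ≻-irrefl : ∀ {x} → ¬ (x ≻ x)
  ≻-irrefl x≻x = asym x≻x x≻x

  ∈-full : ∀ x → x ∈ full T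
  ∈-full x = ∈-tabulate⁺ _ _

  ∈-inN⁺ : ∀ {B v x} → x ∈ B → x ≻ v → x ∈ inN T B v
  ∈-inN⁺ {B} {v} {x} x∈B x≻v = ∈-tabulate⁺ _
    (Equivalence.from T-∧ (fromWitness {a? = x ∈? B} x∈B , fromWitness {a? = x ≻? v} x≻v))

  ∈-inN⁻ : ∀ {B v x} → x ∈ inN T B v → x ∈ B × x ≻ v
  ∈-inN⁻ {B} {v} {x} x∈ with Equivalence.to T-∧ (∈-tabulate⁻ _ x∈)
  ... | t₁ , t₂ = toWitness {a? = x ∈? B} t₁ , toWitness {a? = x ≻? v} t₂

  Dominates : Fin n → Subset n → Set
  Dominates u B = ∀ w → w ∈ B → w ≢ u → u ≻ w

  dominates⇒inN-empty : ∀ {u B} → Dominates u B → ¬ Nonempty (inN T B u)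
  dominates⇒inN-empty {u} dom (y , y∈) with ∈-inN⁻ y∈
  ... | y∈B , y≻u = asym y≻u (dom y y∈B λ { refl → ≻-irrefl y≻u })

  dominates⇒⁅⁆-minimal : ∀ k {u B} → u ∈ B → Dominates u B → minF T k B ⁅ u ⁆
  dominates⇒⁅⁆-minimal k {u} {B} u∈B dom = retentive , minimal
    where
    retentive : retF T k B ⁅ u ⁆
    retentive =
        (λ x∈⁅u⁆ → subst (_∈ B) (sym (x∈⁅y⁆⇒x≡y u x∈⁅u⁆)) u∈B)
      , (u , x∈⁅x⁆ u)
      , λ w w∈⁅u⁆ nonempty → ⊥-elim (dominates⇒inN-empty dom
          (subst (λ z → Nonempty (inN T B z)) (x∈⁅y⁆⇒x≡y u w∈⁅u⁆) nonempty))

    minimal : ∀ A → retF T k B A → ¬ ((A ⊆ ⁅ u ⁆) × (A ≢ ⁅ u ⁆))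
    minimal A (_ , nonempty , _) (A⊆⁅u⁆ , A≢⁅u⁆) = A≢⁅u⁆ (nonempty-⊆⁅x⁆⇒≡⁅x⁆ nonempty A⊆⁅u⁆)

  captain∈τF : ∀ k {u v} → Captain T u v → τF T (suc k) (inN T (full T) v) u
  captain∈τF k {u} (u≻v , cap) = ⁅ u ⁆ , dominates⇒⁅⁆-minimal k u∈N⁻v dom , x∈⁅x⁆ u
    where
    u∈N⁻v = ∈-inN⁺ (∈-full u) u≻v

    dom : Dominates u (inN T (full T) _)
    dom w w∈N⁻v w≢u = cap w (proj₂ (∈-inN⁻ w∈N⁻v)) w≢u

  retentive-captainClosed : ∀ {A} → Retentive T A → ∀ {u v} → Captain T u v → v ∈ A → u ∈ A
  retentive-captainClosed (_ , _ , closed) {u} {v} cap v∈A =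
    closed v v∈A (u , ∈-inN⁺ (∈-full u) (proj₁ cap)) u u∈τ
    where
    u∈τ : τF T n (inN T (full T) v) u
    u∈τ = subst (λ k → τF T k (inN T (full T) v) u)
                (suc-pred n ⦃ nonZeroIndex v ⦄) (captain∈τF (pred n) cap)

  full-retentive : Fin n → Retentive T (full T)
  full-retentive x = id , (x , ∈-full x) , λ _ _ _ y _ → ∈-full y

  hamiltonian⇒retentive≡full : HamiltonianDomCycle T → ∀ {A} → Retentive T A → A ≡ full T
  hamiltonian⇒retentive≡full (m , c , _ , onto , caps , capLast) {A} R@(A⊆ , (y , y∈A) , _) =
    ⊆-antisym A⊆ (λ {x} _ → subst (_∈ A) (proj₂ (onto x)) (onCycle (proj₁ (onto x))))
    where
    P : Fin (suc m) → Set
    P i = c i ∈ A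

    onCycle : ∀ i → P i
    onCycle = cyclicallyClosed⇒all {P = P}
      (λ i → retentive-captainClosed R (caps i))
      (retentive-captainClosed R capLast)
      (subst (_∈ A) (sym (proj₂ (onto y))) y∈A)

theorem9 : (T : Tournament) → HamiltonianDomCycle T →
    ∃ λ (A : Subset (Tournament.n T)) → MinimalRetentive T A ×
      (∀ A' → MinimalRetentive T A' → A' ≡ A)
theorem9 T H@(_ , c , _) =
    full T
  , (full-retentive T (c zero) , λ A R (_ , A≢full) → A≢full (hamiltonian⇒retentive≡full T H R))
  , λ A (R , _) → hamiltonian⇒retentive≡full T H R
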